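{- Let $G$ be a connected graph with no subgraph isomorphic to $Y$, and let $P=v_0v_1\dots v_\ell$ be a longest path in $G$ with $\ell\ge5$. Then every edge $v_jv_k\in E(G)$ with $k\ge j+2$ is one of: $v_iv_{i+2}$ for some $0\le i\le\ell-2$, $v_0v_3$, $v_{\ell-3}v_\ell$, $v_0v_{\ell-1}$, $v_0v_\ell$, $v_1v_{\ell-1}$, or $v_1v_\ell$.
   Context: All graphs are finite and simple. $Y$ is the 7-vertex tree obtained from $K_{1,3}$ by subdividing each edge exactly once. -}

module Defs where

open import Data.Nat using (ℕ; zero; suc; _≤_)
open import Data.Fin using (Fin; inject₁) renaming (zero to fz; suc to fs)
open import Data.Product using (Σ; _×_)
open import Relation.Nullary using (¬_)
open import Function.Definitions using (Injective)
open import Relation.Binary.PropositionalEquality using (_≡_)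
open import Relation.Binary.Construct.Closure.ReflexiveTransitive using (Star)

record Graph (n : ℕ) : Set₁ where
  field
    Adj    : Fin n → Fin n → Set
    sym    : ∀ {x y} → Adj x y → Adj y x
    irrefl : ∀ {x} → ¬ Adj x x
open Graph public

Connected : ∀ {n} → Graph n → Set
Connected {n} G = ∀ (x y : Fin n) → Star (Adj G) x y

IsPath : ∀ {n} → Graph n → (ℓ : ℕ) → (Fin (suc ℓ) → Fin n) → Set
IsPath G ℓ p = Injective _≡_ _≡_ p × (∀ (i : Fin ℓ) → Adj G (p (inject₁ i)) (p (fs i)))

IsLongestPath : ∀ {n} → Graph n → (ℓ : ℕ) → (Fin (suc ℓ) → Fin n) → Set
IsLongestPath {n} G ℓ p = IsPath G ℓ p × (∀ (m : ℕ) (q : Fin (suc m) → Fin n) → IsPath G m q → m ≤ ℓ)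

-- Vertices of Y: 0 = centre; legs 0-1-2, 0-3-4, 0-5-6.
-- G contains a (not necessarily induced) subgraph isomorphic to Y.
HasY : ∀ {n} → Graph n → Set
HasY {n} G = Σ (Fin 7 → Fin n) λ f → Injective _≡_ _≡_ f
  × Adj G (f (# 0)) (f (# 1)) × Adj G (f (# 1)) (f (# 2))
  × Adj G (f (# 0)) (f (# 3)) × Adj G (f (# 3)) (f (# 4))
  × Adj G (f (# 0)) (f (# 5)) × Adj G (f (# 5)) (f (# 6))
  where open import Data.Fin using (#_)

-- Every chord v_j v_k with k ≥ j + 3 outside the list closes a Y together with the path.
-- For j ≥ 2 the centre is v_j, with legs v_{j-1} v_{j-2}, v_{j+1} v_{j+2} and v_k followed by a
-- path neighbour of v_k beyond v_{j+2}; such a neighbour exists unless k = ℓ = j + 3.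
-- For j ≤ 1 and k ≤ ℓ - 2 the centre is v_k, with legs v_{k-1} v_{k-2}, v_{k+1} v_{k+2} and
-- v_j v_{1-j}, which avoid each other once k ≥ 4.
module Submission where

open import Defs hiding (sym)
open import Data.Nat using (ℕ; suc; _+_; _∸_; _≤_; _<_; z≤n; s≤s; NonZero)
open import Data.Nat.Properties
  using ( ≤-refl; ≤-trans; +-comm; +-cancelʳ-≡; +-monoˡ-≤; +-monoˡ-<; <⇒≱; m≤n+m; n≤1+n
        ; m≤n⇒m≤1+n; 1+n≢n; m≤n⇒m<n∨m≡n )
open import Data.Nat.DivMod using (_mod_; m<n⇒m%n≡m)
open import Data.Fin using (Fin; toℕ; fromℕ<; inject₁; splitAt; join; #_) renaming (zero to fz; suc to fs)
open import Data.Fin.Properties using (toℕ-injective; toℕ<n; toℕ≤pred[n]; toℕ-fromℕ<; toℕ-inject₁; join-splitAt)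
import Data.Fin.Permutation.Components as PC
open import Data.Product using (_×_; _,_; proj₁; proj₂)
open import Data.Sum using (_⊎_; inj₁; inj₂; [_,_]′)
open import Data.Empty using (⊥-elim)
open import Function using (_∘_)
open import Function.Definitions using (Injective)
open import Relation.Nullary using (¬_)
open import Relation.Binary.PropositionalEquality using (_≡_; _≢_; refl; sym; trans; cong; subst; subst₂)

[,]-injective : ∀ {a b c} {A : Set a} {B : Set b} {C : Set c} {f : A → C} {g : B → C} →
  Injective _≡_ _≡_ f → Injective _≡_ _≡_ g → (∀ x y → f x ≢ g y) →
  Injective _≡_ _≡_ [ f , g ]′
[,]-injective f-inj g-inj f≢g {inj₁ x} {inj₁ x′} eq = cong inj₁ (f-inj eq)
[,]-injective f-inj g-inj f≢g {inj₁ x} {inj₂ y}  eq = ⊥-elim (f≢g x y eq)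
[,]-injective f-inj g-inj f≢g {inj₂ y} {inj₁ x}  eq = ⊥-elim (f≢g x y (sym eq))
[,]-injective f-inj g-inj f≢g {inj₂ y} {inj₂ y′} eq = cong inj₂ (g-inj eq)

splitAt-injective : ∀ m {n} → Injective _≡_ _≡_ (splitAt m {n})
splitAt-injective m {n} {i} {j} eq =
  trans (sym (join-splitAt m n i)) (trans (cong (join m n) eq) (join-splitAt m n j))

toℕ-mod : ∀ {m n} .{{_ : NonZero n}} → m < n → toℕ (m mod n) ≡ m
toℕ-mod m<n = trans (toℕ-fromℕ< _) (m<n⇒m%n≡m m<n)

m≤n⇒2+m≤n∨m≡n∸1∨m≡n : ∀ {m n} → m ≤ n → 2 + m ≤ n ⊎ m ≡ n ∸ 1 ⊎ m ≡ n
m≤n⇒2+m≤n∨m≡n∸1∨m≡n m≤n with m≤n⇒m<n∨m≡n m≤n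
... | inj₂ m≡n = inj₂ (inj₂ m≡n)
... | inj₁ m<n with m≤n⇒m<n∨m≡n m<n
...   | inj₁ 1+m<n = inj₁ 1+m<n
...   | inj₂ 1+m≡n = inj₂ (inj₁ (cong (_∸ 1) 1+m≡n))

OutsideWindow : ℕ → ℕ → ℕ → Set
OutsideWindow d a w = w < a ⊎ d + a ≤ w

≢-outsideWindow : ∀ {d a i w} → i < d → OutsideWindow d a w → i + a ≢ w
≢-outsideWindow {a = a} {i} i<d (inj₁ w<a) refl = <⇒≱ w<a (m≤n+m a i)
≢-outsideWindow {a = a} i<d (inj₂ d+a≤w) refl = <⇒≱ (+-monoˡ-< a i<d) d+a≤w

-- Y placed on the window a, …, 4 + a and a third leg w, w′; the transposition gives the
-- middle 2 + a the label 0 of the centre in HasY.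
window : ℕ → Fin 5 → ℕ
window a i = toℕ (PC.transpose fz (# 2) i) + a

leg : ℕ → ℕ → Fin 2 → ℕ
leg w w′ fz     = w
leg w w′ (fs _) = w′

spider : ℕ → ℕ → ℕ → Fin 7 → ℕ
spider a w w′ = [ window a , leg w w′ ]′ ∘ splitAt 5

window-injective : ∀ a → Injective _≡_ _≡_ (window a)
window-injective a eq =
  trans (sym (PC.transpose-inverse (# 2) fz))
        (trans (cong (PC.transpose (# 2) fz) (toℕ-injective (+-cancelʳ-≡ a _ _ eq)))
               (PC.transpose-inverse (# 2) fz))

leg-injective : ∀ {w w′} → w ≢ w′ → Injective _≡_ _≡_ (leg w w′)
leg-injective w≢w′ {fz}    {fz}    _  = refl
leg-injective w≢w′ {fz}    {fs fz} eq = ⊥-elim (w≢w′ eq)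
leg-injective w≢w′ {fs fz} {fz}    eq = ⊥-elim (w≢w′ (sym eq))
leg-injective w≢w′ {fs fz} {fs fz} _  = refl

spider-injective : ∀ {a w w′} → OutsideWindow 5 a w → OutsideWindow 5 a w′ → w ≢ w′ →
  Injective _≡_ _≡_ (spider a w w′)
spider-injective {a} out out′ w≢w′ =
  splitAt-injective 5 ∘ [,]-injective (window-injective a) (leg-injective w≢w′) window≢leg
  where
  window≢leg : ∀ i j → window a i ≢ leg _ _ j
  window≢leg i fz      = ≢-outsideWindow (toℕ<n _) out
  window≢leg i (fs fz) = ≢-outsideWindow (toℕ<n _) out′

data ChordShape (ℓ j k : ℕ) : Set where
  v[j]v[j+2] : k ≡ j + 2 → ChordShape ℓ j k
  v₀v₃       : j ≡ 0 → k ≡ 3 → ChordShape ℓ j k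
  v[ℓ-3]vℓ   : j ≡ ℓ ∸ 3 → k ≡ ℓ → ChordShape ℓ j k
  v₀v[ℓ-1]   : j ≡ 0 → k ≡ ℓ ∸ 1 → ChordShape ℓ j k
  v₀vℓ       : j ≡ 0 → k ≡ ℓ → ChordShape ℓ j k
  v₁v[ℓ-1]   : j ≡ 1 → k ≡ ℓ ∸ 1 → ChordShape ℓ j k
  v₁vℓ       : j ≡ 1 → k ≡ ℓ → ChordShape ℓ j k

ChordShape⇒⊎ : ∀ {ℓ j k} → ChordShape ℓ j k →
    (k ≡ j + 2)
    ⊎ (j ≡ 0 × k ≡ 3)
    ⊎ (j ≡ ℓ ∸ 3 × k ≡ ℓ)
    ⊎ (j ≡ 0 × k ≡ ℓ ∸ 1)
    ⊎ (j ≡ 0 × k ≡ ℓ)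
    ⊎ (j ≡ 1 × k ≡ ℓ ∸ 1)
    ⊎ (j ≡ 1 × k ≡ ℓ)
ChordShape⇒⊎ (v[j]v[j+2] k≡j+2) = inj₁ k≡j+2
ChordShape⇒⊎ (v₀v₃ p q)     = inj₂ (inj₁ (p , q))
ChordShape⇒⊎ (v[ℓ-3]vℓ p q) = inj₂ (inj₂ (inj₁ (p , q)))
ChordShape⇒⊎ (v₀v[ℓ-1] p q) = inj₂ (inj₂ (inj₂ (inj₁ (p , q))))
ChordShape⇒⊎ (v₀vℓ p q)     = inj₂ (inj₂ (inj₂ (inj₂ (inj₁ (p , q)))))
ChordShape⇒⊎ (v₁v[ℓ-1] p q) = inj₂ (inj₂ (inj₂ (inj₂ (inj₂ (inj₁ (p , q))))))
ChordShape⇒⊎ (v₁vℓ p q)     = inj₂ (inj₂ (inj₂ (inj₂ (inj₂ (inj₂ (p , q))))))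

module IndexedPath {n} (G : Graph n) (ℓ : ℕ) (v : ℕ → Fin n)
  (v-injective : ∀ {i j} → i ≤ ℓ → j ≤ ℓ → v i ≡ v j → i ≡ j)
  (v-adjacent : ∀ {i} → i < ℓ → Adj G (v i) (v (suc i))) where

  v-adjacent⁻ : ∀ {i} → i < ℓ → Adj G (v (suc i)) (v i)
  v-adjacent⁻ = Graph.sym G ∘ v-adjacent

  spider⇒Y : ∀ {a w w′} → 4 + a ≤ ℓ → w ≤ ℓ → w′ ≤ ℓ →
    OutsideWindow 5 a w → OutsideWindow 5 a w′ → w ≢ w′ →
    Adj G (v (2 + a)) (v w) → Adj G (v w) (v w′) → HasY G
  spider⇒Y {a} {w} {w′} fits w≤ℓ w′≤ℓ out out′ w≢w′ chord w~w′ =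
    v ∘ spider a w w′ ,
    (λ {x} {y} eq → spider-injective out out′ w≢w′ (v-injective (bounded x) (bounded y) eq)) ,
    v-adjacent⁻ (inside (s≤s (s≤s z≤n))) , v-adjacent⁻ (inside (s≤s z≤n)) ,
    v-adjacent (inside (s≤s (s≤s (s≤s z≤n)))) , v-adjacent fits ,
    chord , w~w′
    where
    inside : ∀ {i} → i < 4 → i + a < ℓ
    inside i<4 = ≤-trans (+-monoˡ-< a i<4) fits

    bounded : ∀ x → spider a w w′ x ≤ ℓ
    bounded x with splitAt 5 x
    ... | inj₁ i       = ≤-trans (+-monoˡ-≤ a (toℕ≤pred[n] (PC.transpose fz (# 2) i))) fits
    ... | inj₂ fz      = w≤ℓ
    ... | inj₂ (fs fz) = w′≤ℓ

  chord-from-start⇒Y : ∀ {b w w′} → 6 + b ≤ ℓ → w ≤ 1 → w′ ≤ 1 → w ≢ w′ →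
    Adj G (v w) (v (4 + b)) → Adj G (v w) (v w′) → HasY G
  chord-from-start⇒Y {b} fits w≤1 w′≤1 w≢w′ chord w~w′ =
    spider⇒Y fits (≤-trans w≤1 1≤ℓ) (≤-trans w′≤1 1≤ℓ) (below w≤1) (below w′≤1) w≢w′
      (Graph.sym G chord) w~w′
    where
    1≤ℓ : 1 ≤ ℓ
    1≤ℓ = ≤-trans (s≤s z≤n) fits
    below : ∀ {x} → x ≤ 1 → OutsideWindow 5 (2 + b) x
    below x≤1 = inj₁ (s≤s (≤-trans x≤1 (s≤s z≤n)))

  chord-past-window⇒Y : ∀ {a w w′} → w ≤ ℓ → w′ ≤ ℓ → 5 + a ≤ w → 5 + a ≤ w′ → w ≢ w′ →
    Adj G (v (2 + a)) (v w) → Adj G (v w) (v w′) → HasY G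
  chord-past-window⇒Y w≤ℓ w′≤ℓ 5+a≤w 5+a≤w′ =
    spider⇒Y (≤-trans (n≤1+n _) (≤-trans 5+a≤w w≤ℓ)) w≤ℓ w′≤ℓ (inj₂ 5+a≤w) (inj₂ 5+a≤w′)

  long-chord : ¬ HasY G → ∀ j {k} → 3 + j ≤ k → k ≤ ℓ → Adj G (v j) (v k) → ChordShape ℓ j k
  long-chord noY 0 {3} (s≤s (s≤s (s≤s _))) _ _ = v₀v₃ refl refl
  long-chord noY 0 {suc (suc (suc (suc _)))} (s≤s (s≤s (s≤s _))) k≤ℓ chord
    with m≤n⇒2+m≤n∨m≡n∸1∨m≡n k≤ℓ
  ... | inj₁ fits =
    ⊥-elim (noY (chord-from-start⇒Y fits z≤n ≤-refl (λ ()) chord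
                   (v-adjacent (≤-trans (s≤s z≤n) fits))))
  ... | inj₂ (inj₁ k≡ℓ-1) = v₀v[ℓ-1] refl k≡ℓ-1
  ... | inj₂ (inj₂ k≡ℓ)   = v₀vℓ refl k≡ℓ
  long-chord noY 1 (s≤s (s≤s (s≤s (s≤s _)))) k≤ℓ chord with m≤n⇒2+m≤n∨m≡n∸1∨m≡n k≤ℓ
  ... | inj₁ fits =
    ⊥-elim (noY (chord-from-start⇒Y fits ≤-refl z≤n (λ ()) chord
                   (v-adjacent⁻ (≤-trans (s≤s z≤n) fits))))
  ... | inj₂ (inj₁ k≡ℓ-1) = v₁v[ℓ-1] refl k≡ℓ-1
  ... | inj₂ (inj₂ k≡ℓ)   = v₁vℓ refl k≡ℓ
  long-chord noY (suc (suc a)) 5+a≤k k≤ℓ chord with m≤n⇒m<n∨m≡n k≤ℓ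
  ... | inj₁ k<ℓ =
    ⊥-elim (noY (chord-past-window⇒Y k≤ℓ k<ℓ 5+a≤k (m≤n⇒m≤1+n 5+a≤k) (1+n≢n ∘ sym)
                   chord (v-adjacent k<ℓ)))
  ... | inj₂ k≡ℓ with m≤n⇒m<n∨m≡n 5+a≤k
  ...   | inj₂ 5+a≡k = v[ℓ-3]vℓ (cong (_∸ 3) (trans 5+a≡k k≡ℓ)) k≡ℓ
  ...   | inj₁ (s≤s 5+a≤k-1) =
    ⊥-elim (noY (chord-past-window⇒Y k≤ℓ (≤-trans (n≤1+n _) k≤ℓ) (m≤n⇒m≤1+n 5+a≤k-1) 5+a≤k-1 1+n≢n
                   chord (v-adjacent⁻ k≤ℓ)))

  chord-shape : ¬ HasY G → ∀ {j k} → j + 2 ≤ k → k ≤ ℓ → Adj G (v j) (v k) → ChordShape ℓ j k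
  chord-shape noY {j} {k} j+2≤k k≤ℓ chord with m≤n⇒m<n∨m≡n j+2≤k
  ... | inj₂ j+2≡k = v[j]v[j+2] (sym j+2≡k)
  ... | inj₁ j+2<k = long-chord noY j (subst (_≤ k) (cong suc (+-comm j 2)) j+2<k) k≤ℓ chord

module _ {n} (G : Graph n) {ℓ} {p : Fin (suc ℓ) → Fin n} (path : IsPath G ℓ p) where

  -- p as a sequence indexed by ℕ; indices beyond ℓ wrap around and are never used.
  vertexAt : ℕ → Fin n
  vertexAt m = p (m mod suc ℓ)

  vertexAt-toℕ : ∀ i → vertexAt (toℕ i) ≡ p i
  vertexAt-toℕ i = cong p (toℕ-injective (toℕ-mod (toℕ<n i)))

  vertexAt-injective : ∀ {i j} → i ≤ ℓ → j ≤ ℓ → vertexAt i ≡ vertexAt j → i ≡ j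
  vertexAt-injective i≤ℓ j≤ℓ eq =
    trans (sym (toℕ-mod (s≤s i≤ℓ))) (trans (cong toℕ (proj₁ path eq)) (toℕ-mod (s≤s j≤ℓ)))

  vertexAt-adjacent : ∀ {i} → i < ℓ → Adj G (vertexAt i) (vertexAt (suc i))
  vertexAt-adjacent {i} i<ℓ =
    subst₂ (λ x y → Adj G (p x) (p y)) (toℕ-injective inject₁≡) (toℕ-injective suc≡)
      (proj₂ path (fromℕ< i<ℓ))
    where
    inject₁≡ : toℕ (inject₁ (fromℕ< i<ℓ)) ≡ toℕ (i mod suc ℓ)
    inject₁≡ = trans (toℕ-inject₁ _) (trans (toℕ-fromℕ< i<ℓ) (sym (toℕ-mod (m≤n⇒m≤1+n i<ℓ))))
    suc≡ : suc (toℕ (fromℕ< i<ℓ)) ≡ toℕ (suc i mod suc ℓ)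
    suc≡ = trans (cong suc (toℕ-fromℕ< i<ℓ)) (sym (toℕ-mod (s≤s i<ℓ)))

  open IndexedPath G ℓ vertexAt vertexAt-injective vertexAt-adjacent public using (chord-shape)

lemma2p11 : ∀ {n} (G : Graph n) → Connected G → ¬ HasY G →
    ∀ (ℓ : ℕ) (p : Fin (suc ℓ) → Fin n) → IsLongestPath G ℓ p → 5 ≤ ℓ →
    ∀ (j k : Fin (suc ℓ)) → toℕ j + 2 ≤ toℕ k → Adj G (p j) (p k) →
      (toℕ k ≡ toℕ j + 2)
      ⊎ (toℕ j ≡ 0 × toℕ k ≡ 3)
      ⊎ (toℕ j ≡ ℓ ∸ 3 × toℕ k ≡ ℓ)
      ⊎ (toℕ j ≡ 0 × toℕ k ≡ ℓ ∸ 1)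
      ⊎ (toℕ j ≡ 0 × toℕ k ≡ ℓ)
      ⊎ (toℕ j ≡ 1 × toℕ k ≡ ℓ ∸ 1)
      ⊎ (toℕ j ≡ 1 × toℕ k ≡ ℓ)
lemma2p11 G _ noY ℓ p (path , _) _ j k j+2≤k chord =
  ChordShape⇒⊎ (chord-shape G path noY j+2≤k (toℕ≤pred[n] k) chord′)
  where
  chord′ : Adj G (vertexAt G path (toℕ j)) (vertexAt G path (toℕ k))
  chord′ = subst₂ (Adj G) (sym (vertexAt-toℕ G path j)) (sym (vertexAt-toℕ G path k)) chord
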